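{- Let $n$ be even and let $1 \le a, b < \frac{n}{2}$. If at least one of the following conditions fails, then $T_4(n,a,b)$ is not a nut graph: (i) $\gcd\left(\frac{n}{2}, a, b\right) = 1$; (ii) if $4 \nmid n$, then at least one of $a, b$ is even; (iii) if $4 \mid n$, then $a$ and $b$ are of different parities; (iv) if $10 \mid n$, then at least one of $a, b, a-b, a+b$ is divisible by $5$.
   Context: All graphs are simple. A nut graph is a graph whose adjacency matrix has the eigenvalue $0$ with multiplicity one (nullity one) and whose null space is spanned by a vector with no zero entries. For $n$ even, $T_4(n,a,b)$ is the graph with vertex set $\{x_j, y_j, z_j : j \in \mathbb{Z}_n\}$ (indices modulo $n$) and edge set $\{x_j x_{j+a}, x_j z_j, y_j y_{j+b}, y_j z_j, z_j z_{j+n/2} : j \in \mathbb{Z}_n\}$. -}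

module Defs where

open import Data.Nat as ℕ using (ℕ; zero; suc; NonZero)
open import Data.Nat.DivMod using (_%_; _/_)
open import Data.Nat.Divisibility using (_∣_)
open import Data.Nat.GCD using (gcd)
open import Data.Fin using (Fin; toℕ; remQuot)
open import Data.Bool using (Bool; true; false; _∨_; _∧_; if_then_else_)
open import Relation.Nullary.Decidable using (⌊_⌋)
open import Data.Rational using (ℚ; 0ℚ; 1ℚ; _+_; _*_)
open import Data.Product using (_×_; _,_; ∃)
open import Data.Sum using (_⊎_)
open import Data.Integer as ℤ using (ℤ; +_)
import Data.Integer.Divisibility as ℤDiv
open import Relation.Binary.PropositionalEquality using (_≡_; _≢_)
open import Relation.Nullary using (¬_)

Σ[_] : (N : ℕ) → (Fin N → ℚ) → ℚ
Σ[ zero ] f = 0ℚ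
Σ[ suc N ] f = f Fin.zero + Σ[ N ] (λ i → f (Fin.suc i))
  where import Data.Fin as Fin

adjMatrix : {N : ℕ} → (Fin N → Fin N → Bool) → Fin N → Fin N → ℚ
adjMatrix adj i j = if adj i j then 1ℚ else 0ℚ

_·_ : {N : ℕ} → (Fin N → Fin N → ℚ) → (Fin N → ℚ) → Fin N → ℚ
_·_ {N} A v i = Σ[ N ] (λ j → A i j * v j)

InNullSpace : {N : ℕ} → (Fin N → Fin N → Bool) → (Fin N → ℚ) → Set
InNullSpace adj v = ∀ i → (adjMatrix adj · v) i ≡ 0ℚ

IsNut : {N : ℕ} → (Fin N → Fin N → Bool) → Set
IsNut adj = ∃ λ v → InNullSpace adj v
                  × (∀ i → v i ≢ 0ℚ)
                  × (∀ w → InNullSpace adj w → ∃ λ c → ∀ i → w i ≡ c * v i)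

-- T₄(n,a,b).  Vertex (t , j) with t ∈ {0,1,2} standing for x_j, y_j, z_j.

_≡ᵇ_ : ℕ → ℕ → Bool
m ≡ᵇ k = ⌊ m ℕ.≟ k ⌋

stepᵇ : (n : ℕ) .{{_ : NonZero n}} → ℕ → ℕ → ℕ → Bool
stepᵇ n d i k = ((i ℕ.+ d) % n) ≡ᵇ k

cycEdgeᵇ : (n : ℕ) .{{_ : NonZero n}} → ℕ → ℕ → ℕ → Bool
cycEdgeᵇ n d i k = stepᵇ n d i k ∨ stepᵇ n d k i

T4adj' : (n : ℕ) .{{_ : NonZero n}} → ℕ → ℕ → Fin 3 × Fin n → Fin 3 × Fin n → Bool
T4adj' n a b (Fin.zero , i) (Fin.zero , k) = cycEdgeᵇ n a (toℕ i) (toℕ k)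
  where import Data.Fin as Fin
T4adj' n a b (Fin.suc Fin.zero , i) (Fin.suc Fin.zero , k) = cycEdgeᵇ n b (toℕ i) (toℕ k)
  where import Data.Fin as Fin
T4adj' n a b (Fin.suc (Fin.suc Fin.zero) , i) (Fin.suc (Fin.suc Fin.zero) , k) = cycEdgeᵇ n (n / 2) (toℕ i) (toℕ k)
  where import Data.Fin as Fin
T4adj' n a b (Fin.zero , i) (Fin.suc (Fin.suc Fin.zero) , k) = toℕ i ≡ᵇ toℕ k
  where import Data.Fin as Fin
T4adj' n a b (Fin.suc (Fin.suc Fin.zero) , i) (Fin.zero , k) = toℕ i ≡ᵇ toℕ k
  where import Data.Fin as Fin
T4adj' n a b (Fin.suc Fin.zero , i) (Fin.suc (Fin.suc Fin.zero) , k) = toℕ i ≡ᵇ toℕ k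
  where import Data.Fin as Fin
T4adj' n a b (Fin.suc (Fin.suc Fin.zero) , i) (Fin.suc Fin.zero , k) = toℕ i ≡ᵇ toℕ k
  where import Data.Fin as Fin
T4adj' n a b _ _ = false

T4 : (n : ℕ) .{{_ : NonZero n}} → ℕ → ℕ → Fin (3 ℕ.* n) → Fin (3 ℕ.* n) → Bool
T4 n a b u v = T4adj' n a b (remQuot n u) (remQuot n v)

Cond-i : ℕ → ℕ → ℕ → Set
Cond-i n a b = gcd (gcd (n / 2) a) b ≡ 1

Cond-ii : ℕ → ℕ → ℕ → Set
Cond-ii n a b = ¬ (4 ∣ n) → (2 ∣ a ⊎ 2 ∣ b)

Cond-iii : ℕ → ℕ → ℕ → Set
Cond-iii n a b = 4 ∣ n → ((2 ∣ a × ¬ (2 ∣ b)) ⊎ (¬ (2 ∣ a) × 2 ∣ b))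

Cond-iv : ℕ → ℕ → ℕ → Set
Cond-iv n a b = 10 ∣ n →
  (5 ∣ a ⊎ 5 ∣ b ⊎ (+ 5) ℤDiv.∣ ((+ a) ℤ.- (+ b)) ⊎ 5 ∣ (a ℕ.+ b))

-- A null vector of T₄(n,a,b) is a solution of
--   x_{j+a} + x_{j−a} + z_j = 0,   y_{j+b} + y_{j−b} + z_j = 0,   x_j + y_j + z_{j+n/2} = 0,
-- and (x, y, z) = (1, 1, −2) at every index is one.  When a condition fails there is a
-- second one, non-constant on the x's, that only depends on j modulo a divisor p of n:
-- (i) (1, 1, −2) at the multiples of a common divisor of n/2, a, b and 0 elsewhere;
-- (ii) (−1)^j (1, 1, 2), since a, b and n/2 are odd;  (iii) with a, b odd,
-- x = −y = (1, 0, −1, 0) and z = 0 (a, b both even is an instance of (i));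
-- (iv) explicit vectors modulo 5, chosen by whether a and b are ±1 or ±2 modulo 5.
-- Two independent null vectors contradict nullity one.
module Submission where

open import Algebra.Bundles using (CommutativeMonoid)
import Algebra.Properties.CommutativeSemigroup as CommSemigroupProperties
open import Data.Bool using (Bool; true; false; T; _∨_; if_then_else_)
open import Data.Bool.Properties using (T-∨)
open import Data.Empty using (⊥-elim)
open import Data.Fin as Fin using (Fin; toℕ; fromℕ<; combine; remQuot; _↑ˡ_; _↑ʳ_)
open import Data.Fin.Properties using (all?; toℕ<n; toℕ-fromℕ<; remQuot-combine; combine-remQuot)
open import Data.Integer as ℤ using (_⊖_)
import Data.Integer.Divisibility as ℤDiv
import Data.Integer.Properties as ℤP
open import Data.Nat as ℕ using (ℕ; zero; suc; NonZero; _≤_; _<_; z<s; s<s)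
open import Data.Nat.DivMod
  using (_%_; _/_; %-distribˡ-+; %-remove-+ʳ; m%n%n≡m%n; [m+n]%n≡m%n; m<n⇒m%n≡m; m≡m%n+[m/n]*n;
         m%n<n; m∣n⇒o%n%m≡o%m)
open import Data.Nat.Divisibility
  using (_∣_; _∣?_; divides; 1∣_; ∣-trans; 0∣⇒≡0; m/n∣m; m∣n/o⇒m*o∣n; m*n∣o⇒m∣o/n;
         m%n≡0⇒n∣m; n∣m⇒m%n≡0)
open import Data.Nat.GCD using (gcd; gcd[m,n]∣m; gcd[m,n]∣n)
import Data.Nat.Properties as ℕP
open import Data.Product using (_×_; _,_; uncurry)
open import Data.Rational as ℚ using (ℚ; 0ℚ; 1ℚ; _+_; _*_)
import Data.Rational.Properties as ℚP
open import Data.Sum using (_⊎_; inj₁; inj₂; [_,_])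
open import Function using (_∘_; Equivalence)
open import Relation.Binary.PropositionalEquality hiding ([_])
open import Relation.Nullary using (¬_; yes; no)
open import Relation.Nullary.Decidable
  using (True; toWitness; fromWitness; decidable-stable; _⊎-dec_)

open import Defs

-- Finite sums

ind : Bool → ℚ → ℚ
ind β x = (if β then 1ℚ else 0ℚ) * x

ind-true : ∀ {β} x → T β → ind β x ≡ x
ind-true {true} x _ = ℚP.*-identityˡ x

ind-false : ∀ {β} x → ¬ T β → ind β x ≡ 0ℚ
ind-false {true} x ¬β = ⊥-elim (¬β _)
ind-false {false} x _ = ℚP.*-zeroˡ x

ind-∨ : ∀ {β γ} x → ¬ (T β × T γ) → ind (β ∨ γ) x ≡ ind β x + ind γ x
ind-∨ {true} {true} x ¬both = ⊥-elim (¬both (_ , _))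
ind-∨ {true} {false} x _ = sym (trans (cong (ind true x +_) (ℚP.*-zeroˡ x)) (ℚP.+-identityʳ _))
ind-∨ {false} {γ} x _ = sym (trans (cong (_+ ind γ x) (ℚP.*-zeroˡ x)) (ℚP.+-identityˡ _))

Σ-cong : ∀ N {f g : Fin N → ℚ} → (∀ k → f k ≡ g k) → Σ[ N ] f ≡ Σ[ N ] g
Σ-cong zero f≗g = refl
Σ-cong (suc N) f≗g = cong₂ _+_ (f≗g Fin.zero) (Σ-cong N (f≗g ∘ Fin.suc))

Σ-+ : ∀ N (f g : Fin N → ℚ) → Σ[ N ] (λ k → f k + g k) ≡ Σ[ N ] f + Σ[ N ] g
Σ-+ zero f g = sym (ℚP.+-identityˡ 0ℚ)
Σ-+ (suc N) f g =
  trans (cong (f Fin.zero + g Fin.zero +_) (Σ-+ N (f ∘ Fin.suc) (g ∘ Fin.suc)))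
        (interchange (f Fin.zero) (g Fin.zero) _ _)
  where open CommSemigroupProperties (CommutativeMonoid.commutativeSemigroup ℚP.+-0-commutativeMonoid)

Σ-++ : ∀ m k (f : Fin (m ℕ.+ k) → ℚ) →
  Σ[ m ℕ.+ k ] f ≡ Σ[ m ] (f ∘ (_↑ˡ k)) + Σ[ k ] (f ∘ (m ↑ʳ_))
Σ-++ zero k f = sym (ℚP.+-identityˡ _)
Σ-++ (suc m) k f =
  trans (cong (f Fin.zero +_) (Σ-++ m k (f ∘ Fin.suc))) (sym (ℚP.+-assoc (f Fin.zero) _ _))

Σ-combine : ∀ m n (f : Fin (m ℕ.* n) → ℚ) →
  Σ[ m ℕ.* n ] f ≡ Σ[ m ] (λ t → Σ[ n ] (λ k → f (combine t k)))
Σ-combine zero n f = refl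
Σ-combine (suc m) n f =
  trans (Σ-++ n (m ℕ.* n) f) (cong (Σ[ n ] (f ∘ (_↑ˡ m ℕ.* n)) +_) (Σ-combine m n (f ∘ (n ↑ʳ_))))

Σ-ind-none : ∀ N (P : ℕ → Bool) (g : ℕ → ℚ) → (∀ {k} → k < N → ¬ T (P k)) →
  Σ[ N ] (λ k → ind (P (toℕ k)) (g (toℕ k))) ≡ 0ℚ
Σ-ind-none zero P g none = refl
Σ-ind-none (suc N) P g none =
  trans (cong₂ _+_ (ind-false (g 0) (none z<s)) (Σ-ind-none N (P ∘ suc) (g ∘ suc) (none ∘ s<s)))
        (ℚP.+-identityʳ 0ℚ)

Σ-ind-single : ∀ N (P : ℕ → Bool) (g : ℕ → ℚ) {m} → m < N → T (P m) →
  (∀ {k} → k < N → T (P k) → k ≡ m) → Σ[ N ] (λ k → ind (P (toℕ k)) (g (toℕ k))) ≡ g m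
Σ-ind-single (suc N) P g {zero} _ P0 only =
  trans (cong₂ _+_ (ind-true (g 0) P0)
                   (Σ-ind-none N (P ∘ suc) (g ∘ suc) (λ k<N Pk → ℕP.0≢1+n (sym (only (s<s k<N) Pk)))))
        (ℚP.+-identityʳ (g 0))
Σ-ind-single (suc N) P g {suc m} (s<s m<N) Pm only =
  trans (cong₂ _+_ (ind-false (g 0) (λ P0 → ℕP.0≢1+n (only z<s P0)))
                   (Σ-ind-single N (P ∘ suc) (g ∘ suc) m<N Pm
                                 (λ k<N Pk → ℕP.suc-injective (only (s<s k<N) Pk))))
        (ℚP.+-identityˡ (g (suc m)))

Σ-ind-∨ : ∀ N (P Q : ℕ → Bool) (g : ℕ → ℚ) → (∀ k → ¬ (T (P k) × T (Q k))) →
  Σ[ N ] (λ k → ind (P (toℕ k) ∨ Q (toℕ k)) (g (toℕ k))) ≡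
  Σ[ N ] (λ k → ind (P (toℕ k)) (g (toℕ k))) + Σ[ N ] (λ k → ind (Q (toℕ k)) (g (toℕ k)))
Σ-ind-∨ N P Q g disjoint =
  trans (Σ-cong N (λ k → ind-∨ (g (toℕ k)) (disjoint (toℕ k)))) (Σ-+ N _ _)

-- Arithmetic modulo n

module _ {d : ℕ} .{{_ : NonZero d}} where

  %-absorbˡ : ∀ m k → (m % d ℕ.+ k) % d ≡ (m ℕ.+ k) % d
  %-absorbˡ m k = begin
    (m % d ℕ.+ k) % d           ≡⟨ %-distribˡ-+ (m % d) k d ⟩
    (m % d % d ℕ.+ k % d) % d   ≡⟨ cong (λ r → (r ℕ.+ k % d) % d) (m%n%n≡m%n m d) ⟩
    (m % d ℕ.+ k % d) % d       ≡⟨ %-distribˡ-+ m k d ⟨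
    (m ℕ.+ k) % d               ∎
    where open ≡-Reasoning

  %-absorbʳ : ∀ m k → (m ℕ.+ k % d) % d ≡ (m ℕ.+ k) % d
  %-absorbʳ m k = begin
    (m ℕ.+ k % d) % d  ≡⟨ cong (_% d) (ℕP.+-comm m (k % d)) ⟩
    (k % d ℕ.+ m) % d  ≡⟨ %-absorbˡ k m ⟩
    (k ℕ.+ m) % d      ≡⟨ cong (_% d) (ℕP.+-comm k m) ⟩
    (m ℕ.+ k) % d      ∎
    where open ≡-Reasoning

  %-cong-+ʳ : ∀ {m m′} k → m % d ≡ m′ % d → (m ℕ.+ k) % d ≡ (m′ ℕ.+ k) % d
  %-cong-+ʳ {m} {m′} k eq = begin
    (m ℕ.+ k) % d       ≡⟨ %-absorbˡ m k ⟨
    (m % d ℕ.+ k) % d   ≡⟨ cong (λ r → (r ℕ.+ k) % d) eq ⟩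
    (m′ % d ℕ.+ k) % d  ≡⟨ %-absorbˡ m′ k ⟩
    (m′ ℕ.+ k) % d      ∎
    where open ≡-Reasoning

  %-+-residue : ∀ {k κ} m → k % d ≡ κ → (m ℕ.+ k) % d ≡ (m % d ℕ.+ κ) % d
  %-+-residue {k} m refl = trans (sym (%-absorbʳ m k)) (sym (%-absorbˡ m (k % d)))

  ≡-mod⇒∣∸ : ∀ {m n} → m % d ≡ n % d → d ∣ m ℕ.∸ n
  ≡-mod⇒∣∸ {m} {n} eq = divides (m / d ℕ.∸ n / d) (begin
    m ℕ.∸ n                                               ≡⟨ cong₂ ℕ._∸_ (m≡m%n+[m/n]*n m d) (m≡m%n+[m/n]*n n d) ⟩
    (m % d ℕ.+ m / d ℕ.* d) ℕ.∸ (n % d ℕ.+ n / d ℕ.* d)   ≡⟨ cong (λ r → (m % d ℕ.+ m / d ℕ.* d) ℕ.∸ (r ℕ.+ n / d ℕ.* d)) eq ⟨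
    (m % d ℕ.+ m / d ℕ.* d) ℕ.∸ (m % d ℕ.+ n / d ℕ.* d)   ≡⟨ ℕP.[m+n]∸[m+o]≡n∸o (m % d) _ _ ⟩
    m / d ℕ.* d ℕ.∸ n / d ℕ.* d                           ≡⟨ ℕP.*-distribʳ-∸ d (m / d) (n / d) ⟨
    (m / d ℕ.∸ n / d) ℕ.* d                               ∎)
    where open ≡-Reasoning

  ≡-mod⇒∣- : ∀ m n → m % d ≡ n % d → (ℤ.+ d) ℤDiv.∣ (ℤ.+ m ℤ.- ℤ.+ n)
  ≡-mod⇒∣- m n eq = subst (λ k → d ∣ ℤ.∣ k ∣) (sym (ℤP.m-n≡m⊖n m n)) (by-order (ℕP.≤-total m n))
    where
    by-order : m ≤ n ⊎ n ≤ m → d ∣ ℤ.∣ m ⊖ n ∣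
    by-order (inj₁ m≤n) = subst (d ∣_) (sym (ℤP.∣⊖∣-≤ m≤n)) (≡-mod⇒∣∸ (sym eq))
    by-order (inj₂ n≤m) = subst (d ∣_) (sym (trans (ℤP.∣m⊖n∣≡∣n⊖m∣ m n) (ℤP.∣⊖∣-≤ n≤m))) (≡-mod⇒∣∸ eq)

module _ {n : ℕ} .{{_ : NonZero n}} where

  %-shift-inverse : ∀ {d e k i} → d ℕ.+ e ≡ n → k < n → (k ℕ.+ d) % n ≡ i → (i ℕ.+ e) % n ≡ k
  %-shift-inverse {d} {e} {k} d+e≡n k<n refl = begin
    ((k ℕ.+ d) % n ℕ.+ e) % n  ≡⟨ %-absorbˡ (k ℕ.+ d) e ⟩
    (k ℕ.+ d ℕ.+ e) % n        ≡⟨ cong (_% n) (trans (ℕP.+-assoc k d e) (cong (k ℕ.+_) d+e≡n)) ⟩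
    (k ℕ.+ n) % n              ≡⟨ [m+n]%n≡m%n k n ⟩
    k % n                      ≡⟨ m<n⇒m%n≡m k<n ⟩
    k                          ∎
    where open ≡-Reasoning

  %-shift-≢ : ∀ x {c} → 0 < c → c < n → (x ℕ.+ c) % n ≢ x
  %-shift-≢ x {c} 0<c c<n eq = multiple-of-n ((x ℕ.+ c) / n) c≡q*n
    where
    c≡q*n : c ≡ (x ℕ.+ c) / n ℕ.* n
    c≡q*n = ℕP.+-cancelˡ-≡ x c _ (trans (m≡m%n+[m/n]*n (x ℕ.+ c) n) (cong (ℕ._+ (x ℕ.+ c) / n ℕ.* n) eq))
    multiple-of-n : ∀ q → c ≢ q ℕ.* n
    multiple-of-n zero c≡0 = ℕP.<-irrefl (sym c≡0) 0<c
    multiple-of-n (suc q) c≡n+q*n = ℕP.<-irrefl refl (ℕP.<-≤-trans c<n (subst (n ≤_) (sym c≡n+q*n) (ℕP.m≤m+n n _)))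

  %-step-twice-≢ : ∀ {d i k} → 0 < d → d ℕ.+ d < n → (i ℕ.+ d) % n ≡ k → (k ℕ.+ d) % n ≢ i
  %-step-twice-≢ {d} {i} 0<d 2d<n refl eq = %-shift-≢ i (ℕP.+-mono-< 0<d 0<d) 2d<n (begin
    (i ℕ.+ (d ℕ.+ d)) % n       ≡⟨ cong (_% n) (ℕP.+-assoc i d d) ⟨
    (i ℕ.+ d ℕ.+ d) % n         ≡⟨ %-absorbˡ (i ℕ.+ d) d ⟨
    ((i ℕ.+ d) % n ℕ.+ d) % n   ≡⟨ eq ⟩
    i                           ∎)
    where open ≡-Reasoning

m+m<n⇒m≤n : ∀ {m n} → m ℕ.+ m < n → m ≤ n
m+m<n⇒m≤n {m} m+m<n = ℕP.≤-trans (ℕP.m≤m+n m m) (ℕP.<⇒≤ m+m<n)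

half+half : ∀ {n} → 2 ∣ n → n / 2 ℕ.+ n / 2 ≡ n
half+half {n} 2∣n = begin
  n / 2 ℕ.+ n / 2          ≡⟨ cong (n / 2 ℕ.+_) (ℕP.+-identityʳ (n / 2)) ⟨
  2 ℕ.* (n / 2)            ≡⟨ ℕP.*-comm 2 (n / 2) ⟩
  n / 2 ℕ.* 2              ≡⟨ cong (ℕ._+ n / 2 ℕ.* 2) (n∣m⇒m%n≡0 n 2 2∣n) ⟨
  n % 2 ℕ.+ n / 2 ℕ.* 2    ≡⟨ m≡m%n+[m/n]*n n 2 ⟨
  n                        ∎
  where open ≡-Reasoning

∣-≢1⇒1< : ∀ {d m} → 0 < m → d ∣ m → d ≢ 1 → 1 < d
∣-≢1⇒1< {zero} 0<m 0∣m _ = ⊥-elim (ℕP.<⇒≢ 0<m (sym (0∣⇒≡0 0∣m)))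
∣-≢1⇒1< {suc zero} _ _ d≢1 = ⊥-elim (d≢1 refl)
∣-≢1⇒1< {suc (suc d)} _ _ _ = s<s z<s

odd⇒%2≡1 : ∀ m → ¬ 2 ∣ m → m % 2 ≡ 1
odd⇒%2≡1 m ¬2∣m with m % 2 in eq | m%n<n m 2
... | 0 | _ = ⊥-elim (¬2∣m (m%n≡0⇒n∣m m 2 eq))
... | 1 | _ = refl
... | suc (suc _) | s<s (s<s ())

odd⇒%4≡1∨3 : ∀ m → ¬ 2 ∣ m → m % 4 ≡ 1 ⊎ m % 4 ≡ 3
odd⇒%4≡1∨3 m ¬2∣m with m % 4 | m%n<n m 4 | m∣n⇒o%n%m≡o%m 2 4 m (divides 2 refl)
... | 0 | _ | 0≡m%2 = ⊥-elim (ℕP.0≢1+n (trans 0≡m%2 (odd⇒%2≡1 m ¬2∣m)))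
... | 1 | _ | _ = inj₁ refl
... | 2 | _ | 0≡m%2 = ⊥-elim (ℕP.0≢1+n (trans 0≡m%2 (odd⇒%2≡1 m ¬2∣m)))
... | 3 | _ | _ = inj₂ refl
... | suc (suc (suc (suc _))) | s<s (s<s (s<s (s<s ()))) | _

±1 ±2 : ℕ → Set
±1 α = α ≡ 1 ⊎ α ≡ 4
±2 α = α ≡ 2 ⊎ α ≡ 3

nonzero-residues-mod5 : ∀ {α β} → α < 5 → β < 5 → α ≢ 0 → β ≢ 0 → α ≢ β → (α ℕ.+ β) % 5 ≢ 0 →
  (±1 α × ±2 β) ⊎ (±2 α × ±1 β)
nonzero-residues-mod5 {0} _ _ α≢0 _ _ _ = ⊥-elim (α≢0 refl)
nonzero-residues-mod5 {_} {0} _ _ _ β≢0 _ _ = ⊥-elim (β≢0 refl)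
nonzero-residues-mod5 {1} {2} _ _ _ _ _ _ = inj₁ (inj₁ refl , inj₁ refl)
nonzero-residues-mod5 {1} {3} _ _ _ _ _ _ = inj₁ (inj₁ refl , inj₂ refl)
nonzero-residues-mod5 {4} {2} _ _ _ _ _ _ = inj₁ (inj₂ refl , inj₁ refl)
nonzero-residues-mod5 {4} {3} _ _ _ _ _ _ = inj₁ (inj₂ refl , inj₂ refl)
nonzero-residues-mod5 {2} {1} _ _ _ _ _ _ = inj₂ (inj₁ refl , inj₁ refl)
nonzero-residues-mod5 {2} {4} _ _ _ _ _ _ = inj₂ (inj₁ refl , inj₂ refl)
nonzero-residues-mod5 {3} {1} _ _ _ _ _ _ = inj₂ (inj₂ refl , inj₁ refl)
nonzero-residues-mod5 {3} {4} _ _ _ _ _ _ = inj₂ (inj₂ refl , inj₂ refl)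
nonzero-residues-mod5 {1} {1} _ _ _ _ α≢β _ = ⊥-elim (α≢β refl)
nonzero-residues-mod5 {2} {2} _ _ _ _ α≢β _ = ⊥-elim (α≢β refl)
nonzero-residues-mod5 {3} {3} _ _ _ _ α≢β _ = ⊥-elim (α≢β refl)
nonzero-residues-mod5 {4} {4} _ _ _ _ α≢β _ = ⊥-elim (α≢β refl)
nonzero-residues-mod5 {1} {4} _ _ _ _ _ α+β≢0 = ⊥-elim (α+β≢0 refl)
nonzero-residues-mod5 {4} {1} _ _ _ _ _ α+β≢0 = ⊥-elim (α+β≢0 refl)
nonzero-residues-mod5 {2} {3} _ _ _ _ _ α+β≢0 = ⊥-elim (α+β≢0 refl)
nonzero-residues-mod5 {3} {2} _ _ _ _ _ α+β≢0 = ⊥-elim (α+β≢0 refl)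
nonzero-residues-mod5 {suc (suc (suc (suc (suc _))))} (s<s (s<s (s<s (s<s (s<s ()))))) _ _ _ _ _
nonzero-residues-mod5 {_} {suc (suc (suc (suc (suc _))))} _ (s<s (s<s (s<s (s<s (s<s ()))))) _ _ _ _

-- Rows of circulant matrices

module _ {n : ℕ} .{{_ : NonZero n}} where

  Σ-≡ᵇ : ∀ {i} (g : ℕ → ℚ) → i < n → Σ[ n ] (λ k → ind (i ≡ᵇ toℕ k) (g (toℕ k))) ≡ g i
  Σ-≡ᵇ {i} g i<n = Σ-ind-single n (i ≡ᵇ_) g i<n (fromWitness refl) (λ _ eq → sym (toWitness eq))

  Σ-cycEdge : ∀ {d i} (g : ℕ → ℚ) → 0 < d → d ℕ.+ d < n → i < n →
    Σ[ n ] (λ k → ind (cycEdgeᵇ n d i (toℕ k)) (g (toℕ k))) ≡ g ((i ℕ.+ d) % n) + g ((i ℕ.+ (n ℕ.∸ d)) % n)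
  Σ-cycEdge {d} {i} g 0<d 2d<n i<n =
    trans (Σ-ind-∨ n (stepᵇ n d i) (λ k → stepᵇ n d k i) g
                   (λ k (fwd , bwd) → %-step-twice-≢ 0<d 2d<n (toWitness fwd) (toWitness bwd)))
          (cong₂ _+_ (Σ-ind-single n (stepᵇ n d i) g (m%n<n _ n) (fromWitness refl) (λ _ eq → sym (toWitness eq)))
                     (Σ-ind-single n (λ k → stepᵇ n d k i) g (m%n<n _ n)
                       (fromWitness (%-shift-inverse (ℕP.m∸n+n≡m d≤n) i<n refl))
                       (λ k<n eq → sym (%-shift-inverse (ℕP.m+[n∸m]≡n d≤n) k<n (toWitness eq)))))
    where
    d≤n : d ≤ n
    d≤n = m+m<n⇒m≤n 2d<n

  Σ-cycEdge-antipodal : ∀ {h i} (g : ℕ → ℚ) → h ℕ.+ h ≡ n → i < n →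
    Σ[ n ] (λ k → ind (cycEdgeᵇ n h i (toℕ k)) (g (toℕ k))) ≡ g ((i ℕ.+ h) % n)
  Σ-cycEdge-antipodal {h} {i} g h+h≡n i<n =
    Σ-ind-single n (cycEdgeᵇ n h i) g (m%n<n _ n) (Equivalence.from (T-∨ {stepᵇ n h i _}) (inj₁ (fromWitness refl))) only
    where
    only : ∀ {k} → k < n → T (cycEdgeᵇ n h i k) → k ≡ (i ℕ.+ h) % n
    only {k} k<n eq = [ sym ∘ toWitness , (λ bwd → sym (%-shift-inverse h+h≡n k<n (toWitness bwd))) ]
                      (Equivalence.to (T-∨ {stepᵇ n h i k} {stepᵇ n h k i}) eq)

-- Vectors that only depend on the index modulo p

module _ (p : ℕ) .{{_ : NonZero p}} where

  periodic : (Fin 3 → ℕ → ℚ) → Fin 3 → ℕ → ℚ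
  periodic F t m = F t (m % p)

  -- The row equations at x_j (f and g being the values on the x's and the z's) and at z_j.
  -- The first is written from m = j − d so that no subtraction occurs.
  record CycleRow (d : ℕ) (f g : ℕ → ℚ) : Set where
    constructor cycleRow
    field cycle-eq : ∀ m → f ((m ℕ.+ d ℕ.+ d) % p) + f (m % p) + g ((m ℕ.+ d) % p) ≡ 0ℚ

  record AntipodalRow (h : ℕ) (f g k : ℕ → ℚ) : Set where
    constructor antipodalRow
    field antipodal-eq : ∀ m → f (m % p) + g (m % p) + k ((m ℕ.+ h) % p) ≡ 0ℚ

  open CycleRow public
  open AntipodalRow public

  at-residue : ∀ {P : ℕ → Set} → (∀ (r : Fin p) → P (toℕ r)) → ∀ m → P (m % p)
  at-residue {P} P-all m = subst P (toℕ-fromℕ< (m%n<n m p)) (P-all (fromℕ< (m%n<n m p)))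

  CycleRow-by-residues : ∀ {d f g} δ → d % p ≡ δ →
    (∀ (r : Fin p) → f ((toℕ r ℕ.+ δ ℕ.+ δ) % p) + f (toℕ r) + g ((toℕ r ℕ.+ δ) % p) ≡ 0ℚ) →
    CycleRow d f g
  CycleRow-by-residues {d} {f} {g} δ d≡δ check = cycleRow vanishes
    where
    once : ∀ m → (m ℕ.+ d) % p ≡ (m % p ℕ.+ δ) % p
    once m = %-+-residue m d≡δ
    twice : ∀ m → (m ℕ.+ d ℕ.+ d) % p ≡ (m % p ℕ.+ δ ℕ.+ δ) % p
    twice m = begin
      (m ℕ.+ d ℕ.+ d) % p                ≡⟨ %-+-residue (m ℕ.+ d) d≡δ ⟩
      ((m ℕ.+ d) % p ℕ.+ δ) % p          ≡⟨ cong (λ r → (r ℕ.+ δ) % p) (once m) ⟩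
      ((m % p ℕ.+ δ) % p ℕ.+ δ) % p      ≡⟨ %-absorbˡ (m % p ℕ.+ δ) δ ⟩
      (m % p ℕ.+ δ ℕ.+ δ) % p            ∎
      where open ≡-Reasoning
    vanishes : ∀ m → f ((m ℕ.+ d ℕ.+ d) % p) + f (m % p) + g ((m ℕ.+ d) % p) ≡ 0ℚ
    vanishes m = trans (cong₂ (λ u w → f u + f (m % p) + g w) (twice m) (once m))
                       (at-residue {λ r → f ((r ℕ.+ δ ℕ.+ δ) % p) + f r + g ((r ℕ.+ δ) % p) ≡ 0ℚ} check m)

  AntipodalRow-by-residues : ∀ {h f g k} η → h % p ≡ η →
    (∀ (r : Fin p) → f (toℕ r) + g (toℕ r) + k ((toℕ r ℕ.+ η) % p) ≡ 0ℚ) → AntipodalRow h f g k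
  AntipodalRow-by-residues {h} {f} {g} {k} η h≡η check = antipodalRow λ m →
    trans (cong (λ w → f (m % p) + g (m % p) + k w) (%-+-residue m h≡η))
          (at-residue {λ r → f r + g r + k ((r ℕ.+ η) % p) ≡ 0ℚ} check m)

  CycleRow-multiple : ∀ {d f g} → p ∣ d → (∀ r → f r + f r + g r ≡ 0ℚ) → CycleRow d f g
  CycleRow-multiple {d} {f} {g} p∣d check = cycleRow λ m →
    trans (cong₂ (λ u w → f u + f (m % p) + g w)
                 (trans (%-remove-+ʳ (m ℕ.+ d) p∣d) (%-remove-+ʳ m p∣d)) (%-remove-+ʳ m p∣d))
          (check (m % p))

  AntipodalRow-multiple : ∀ {h f g k} → p ∣ h → (∀ r → f r + g r + k r ≡ 0ℚ) → AntipodalRow h f g k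
  AntipodalRow-multiple {h} {f} {g} {k} p∣h check = antipodalRow λ m →
    trans (cong (λ w → f (m % p) + g (m % p) + k w) (%-remove-+ʳ m p∣h)) (check (m % p))

decide-vanishing : ∀ {p} (e : Fin p → ℚ) → True (all? (λ r → e r ℚP.≟ 0ℚ)) → ∀ r → e r ≡ 0ℚ
decide-vanishing e = toWitness

¬IsNut-of-independent : ∀ {N} (adj : Fin N → Fin N → Bool) {v w : Fin N → ℚ} →
  InNullSpace adj v → InNullSpace adj w → ∀ i j → v i * w j ≢ v j * w i → ¬ IsNut adj
¬IsNut-of-independent adj {v} {w} v-null w-null i j independent (u , _ , _ , spans)
  with spans v v-null | spans w w-null
... | c , v≡cu | d , w≡du = independent (begin
  v i * w j              ≡⟨ cong₂ _*_ (v≡cu i) (w≡du j) ⟩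
  c * u i * (d * u j)    ≡⟨ interchange c (u i) d (u j) ⟩
  c * d * (u i * u j)    ≡⟨ cong (c * d *_) (ℚP.*-comm (u i) (u j)) ⟩
  c * d * (u j * u i)    ≡⟨ interchange c (u j) d (u i) ⟨
  c * u j * (d * u i)    ≡⟨ cong₂ _*_ (v≡cu j) (w≡du i) ⟨
  v j * w i              ∎)
  where
  open ≡-Reasoning
  open CommSemigroupProperties (CommutativeMonoid.commutativeSemigroup ℚP.*-1-commutativeMonoid)

-- The null vectors

pattern X = Fin.zero
pattern Y = Fin.suc Fin.zero
pattern Z = Fin.suc (Fin.suc Fin.zero)

-1ℚ : ℚ
-1ℚ = ℚ.- 1ℚ

2ℚ : ℚ
2ℚ = 1ℚ + 1ℚ

-2ℚ : ℚ
-2ℚ = ℚ.- 2ℚ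

⟨_,_,_⟩ : {A : Set} → A → A → A → Fin 3 → A
⟨ x , y , z ⟩ X = x
⟨ x , y , z ⟩ Y = y
⟨ x , y , z ⟩ Z = z

-- With period 1 this is the constant null vector.
at-zero : Fin 3 → ℕ → ℚ
at-zero t zero = ⟨ 1ℚ , 1ℚ , -2ℚ ⟩ t
at-zero t (suc _) = 0ℚ

alternating : Fin 3 → ℕ → ℚ
alternating t zero = ⟨ 1ℚ , 1ℚ , 2ℚ ⟩ t
alternating t (suc _) = ℚ.- alternating t zero

wave : ℕ → ℚ
wave 0 = 1ℚ
wave 2 = -1ℚ
wave _ = 0ℚ

-- Values modulo 5 on the cycle of a shift ≡ ±1, on that of a shift ≡ ±2, and on the z's.
pent₁ pent₂ pentᶻ : ℕ → ℚ
pent₁ 0 = 1ℚ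
pent₁ 1 = -1ℚ
pent₁ _ = 0ℚ
pent₂ 0 = -2ℚ
pent₂ 1 = 2ℚ
pent₂ 2 = -1ℚ
pent₂ 3 = 0ℚ
pent₂ _ = 1ℚ
pentᶻ 0 = 1ℚ
pentᶻ 1 = -1ℚ
pentᶻ 2 = 1ℚ
pentᶻ 3 = 0ℚ
pentᶻ _ = -1ℚ

pent₁-row : ∀ {d} → ±1 (d % 5) → CycleRow 5 d pent₁ pentᶻ
pent₁-row (inj₁ d≡1) = CycleRow-by-residues 5 1 d≡1 (decide-vanishing _ _)
pent₁-row (inj₂ d≡4) = CycleRow-by-residues 5 4 d≡4 (decide-vanishing _ _)

pent₂-row : ∀ {d} → ±2 (d % 5) → CycleRow 5 d pent₂ pentᶻ
pent₂-row (inj₁ d≡2) = CycleRow-by-residues 5 2 d≡2 (decide-vanishing _ _)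
pent₂-row (inj₂ d≡3) = CycleRow-by-residues 5 3 d≡3 (decide-vanishing _ _)

-- The adjacency matrix of T₄(n,a,b)

module T₄ (n a b : ℕ) .{{_ : NonZero n}} where

  vertex : Fin 3 → Fin n → Fin (3 ℕ.* n)
  vertex = combine

  lift : (Fin 3 → ℕ → ℚ) → Fin (3 ℕ.* n) → ℚ
  lift H = uncurry (λ t j → H t (toℕ j)) ∘ remQuot n

  lift-vertex : ∀ H t j → lift H (vertex t j) ≡ H t (toℕ j)
  lift-vertex H t j = cong (uncurry (λ t j → H t (toℕ j))) (remQuot-combine t j)

  private
    A : Fin (3 ℕ.* n) → Fin (3 ℕ.* n) → ℚ
    A = adjMatrix (T4 n a b)

  row : ∀ H s i → (A · lift H) (vertex s i) ≡
    Σ[ 3 ] (λ t → Σ[ n ] (λ k → ind (T4adj' n a b (s , i) (t , k)) (H t (toℕ k))))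
  row H s i = trans (Σ-combine 3 n _)
    (Σ-cong 3 (λ t → Σ-cong n (λ k → cong₂ entry (remQuot-combine s i) (remQuot-combine t k))))
    where
    entry : Fin 3 × Fin n → Fin 3 × Fin n → ℚ
    entry u v = (if T4adj' n a b u v then 1ℚ else 0ℚ) * uncurry (λ t j → H t (toℕ j)) v

  row-x : ∀ H i → 0 < a → a ℕ.+ a < n → (A · lift H) (vertex X i) ≡
    H X ((toℕ i ℕ.+ a) % n) + H X ((toℕ i ℕ.+ (n ℕ.∸ a)) % n) + H Z (toℕ i)
  row-x H i 0<a 2a<n = begin
    (A · lift H) (vertex X i)     ≡⟨ row H X i ⟩
    _                             ≡⟨ cong₂ _+_ (Σ-cycEdge (H X) 0<a 2a<n (toℕ<n i))
                                       (cong₂ _+_ (Σ-ind-none n (λ _ → false) (H Y) (λ _ ()))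
                                                  (cong (_+ 0ℚ) (Σ-≡ᵇ (H Z) (toℕ<n i)))) ⟩
    x⁺ + x⁻ + (0ℚ + (z + 0ℚ))     ≡⟨ cong (x⁺ + x⁻ +_) (trans (ℚP.+-identityˡ _) (ℚP.+-identityʳ z)) ⟩
    x⁺ + x⁻ + z                   ∎
    where
    open ≡-Reasoning
    x⁺ = H X ((toℕ i ℕ.+ a) % n)
    x⁻ = H X ((toℕ i ℕ.+ (n ℕ.∸ a)) % n)
    z = H Z (toℕ i)

  row-y : ∀ H i → 0 < b → b ℕ.+ b < n → (A · lift H) (vertex Y i) ≡
    H Y ((toℕ i ℕ.+ b) % n) + H Y ((toℕ i ℕ.+ (n ℕ.∸ b)) % n) + H Z (toℕ i)
  row-y H i 0<b 2b<n = begin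
    (A · lift H) (vertex Y i)     ≡⟨ row H Y i ⟩
    _                             ≡⟨ cong₂ _+_ (Σ-ind-none n (λ _ → false) (H X) (λ _ ()))
                                       (cong₂ _+_ (Σ-cycEdge (H Y) 0<b 2b<n (toℕ<n i))
                                                  (cong (_+ 0ℚ) (Σ-≡ᵇ (H Z) (toℕ<n i)))) ⟩
    0ℚ + (y⁺ + y⁻ + (z + 0ℚ))     ≡⟨ trans (ℚP.+-identityˡ _) (cong (y⁺ + y⁻ +_) (ℚP.+-identityʳ z)) ⟩
    y⁺ + y⁻ + z                   ∎
    where
    open ≡-Reasoning
    y⁺ = H Y ((toℕ i ℕ.+ b) % n)
    y⁻ = H Y ((toℕ i ℕ.+ (n ℕ.∸ b)) % n)
    z = H Z (toℕ i)

  row-z : ∀ H i → n / 2 ℕ.+ n / 2 ≡ n → (A · lift H) (vertex Z i) ≡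
    H X (toℕ i) + H Y (toℕ i) + H Z ((toℕ i ℕ.+ n / 2) % n)
  row-z H i h+h≡n = begin
    (A · lift H) (vertex Z i)     ≡⟨ row H Z i ⟩
    _                             ≡⟨ cong₂ _+_ (Σ-≡ᵇ (H X) (toℕ<n i))
                                       (cong₂ _+_ (Σ-≡ᵇ (H Y) (toℕ<n i))
                                                  (cong (_+ 0ℚ) (Σ-cycEdge-antipodal (H Z) h+h≡n (toℕ<n i)))) ⟩
    x + (y + (z + 0ℚ))            ≡⟨ cong (λ r → x + (y + r)) (ℚP.+-identityʳ z) ⟩
    x + (y + z)                   ≡⟨ ℚP.+-assoc x y z ⟨
    x + y + z                     ∎
    where
    open ≡-Reasoning
    x = H X (toℕ i)
    y = H Y (toℕ i)
    z = H Z ((toℕ i ℕ.+ n / 2) % n)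

  module _ {p : ℕ} .{{_ : NonZero p}} (p∣n : p ∣ n) where

    private
      %n%p : ∀ m → m % n % p ≡ m % p
      %n%p m = m∣n⇒o%n%m≡o%m p n m p∣n

    CycleRow⇒row : ∀ {d f g} → d ≤ n → CycleRow p d f g → ∀ i →
      f ((i ℕ.+ d) % n % p) + f ((i ℕ.+ (n ℕ.∸ d)) % n % p) + g (i % p) ≡ 0ℚ
    CycleRow⇒row {d} {f} {g} d≤n eqs i = begin
      f ((i ℕ.+ d) % n % p) + f (m % n % p) + g (i % p)
        ≡⟨ cong₂ (λ u w → f u + f w + g (i % p)) (%n%p (i ℕ.+ d)) (%n%p m) ⟩
      f ((i ℕ.+ d) % p) + f (m % p) + g (i % p)
        ≡⟨ cong₂ (λ u w → f u + f (m % p) + g w) (sym (%-cong-+ʳ d m+d≡i)) (sym m+d≡i) ⟩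
      f ((m ℕ.+ d ℕ.+ d) % p) + f (m % p) + g ((m ℕ.+ d) % p)
        ≡⟨ cycle-eq eqs m ⟩
      0ℚ ∎
      where
      open ≡-Reasoning
      m = i ℕ.+ (n ℕ.∸ d)
      m+d≡i : (m ℕ.+ d) % p ≡ i % p
      m+d≡i = trans (cong (_% p) (trans (ℕP.+-assoc i (n ℕ.∸ d) d) (cong (i ℕ.+_) (ℕP.m∸n+n≡m d≤n))))
                    (%-remove-+ʳ i p∣n)

    periodic-null : 0 < a → a ℕ.+ a < n → 0 < b → b ℕ.+ b < n → n / 2 ℕ.+ n / 2 ≡ n → ∀ F →
      CycleRow p a (F X) (F Z) → CycleRow p b (F Y) (F Z) → AntipodalRow p (n / 2) (F X) (F Y) (F Z) →
      InNullSpace (T4 n a b) (lift (periodic p F))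
    periodic-null 0<a 2a<n 0<b 2b<n h+h≡n F x-rows y-rows z-rows u =
      subst (λ w → (A · v) w ≡ 0ℚ) (combine-remQuot {3} n u) (rows (remQuot n u))
      where
      v = lift (periodic p F)
      rows : ∀ ti → (A · v) (uncurry vertex ti) ≡ 0ℚ
      rows (X , i) = trans (row-x (periodic p F) i 0<a 2a<n) (CycleRow⇒row (m+m<n⇒m≤n 2a<n) x-rows (toℕ i))
      rows (Y , i) = trans (row-y (periodic p F) i 0<b 2b<n) (CycleRow⇒row (m+m<n⇒m≤n 2b<n) y-rows (toℕ i))
      rows (Z , i) = trans (row-z (periodic p F) i h+h≡n)
        (trans (cong (λ w → F X (toℕ i % p) + F Y (toℕ i % p) + F Z w) (%n%p (toℕ i ℕ.+ n / 2)))
               (antipodal-eq z-rows (toℕ i)))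

  module Necessary (2∣n : 2 ∣ n) (0<a : 0 < a) (a<n/2 : a < n / 2) (0<b : 0 < b) (b<n/2 : b < n / 2) where

    private
      double<n : ∀ {d} → d < n / 2 → d ℕ.+ d < n
      double<n d<n/2 = subst (_ <_) (half+half 2∣n) (ℕP.+-mono-< d<n/2 d<n/2)

      1<n : 1 < n
      1<n = ℕP.≤-<-trans 0<a (ℕP.≤-<-trans (ℕP.m≤m+n a a) (double<n a<n/2))

      0<n : 0 < n
      0<n = ℕP.<-trans z<s 1<n

      null : ∀ {p} .{{_ : NonZero p}} → p ∣ n → ∀ F →
        CycleRow p a (F X) (F Z) → CycleRow p b (F Y) (F Z) → AntipodalRow p (n / 2) (F X) (F Y) (F Z) →
        InNullSpace (T4 n a b) (lift (periodic p F))
      null p∣n = periodic-null p∣n 0<a (double<n a<n/2) 0<b (double<n b<n/2) (half+half 2∣n)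

      x-value : ∀ {p} .{{_ : NonZero p}} F {k} (k<n : k < n) →
        lift (periodic p F) (vertex X (fromℕ< k<n)) ≡ F X (k % p)
      x-value {p} F k<n =
        trans (lift-vertex (periodic p F) X (fromℕ< k<n)) (cong (λ j → F X (j % p)) (toℕ-fromℕ< k<n))

    null-at-multiples : ∀ d .{{_ : NonZero d}} → d ∣ n / 2 → d ∣ a → d ∣ b →
      InNullSpace (T4 n a b) (lift (periodic d at-zero))
    null-at-multiples d d∣n/2 d∣a d∣b = null (∣-trans d∣n/2 (m/n∣m 2∣n)) at-zero
      (CycleRow-multiple d d∣a λ { zero → refl ; (suc _) → refl })
      (CycleRow-multiple d d∣b λ { zero → refl ; (suc _) → refl })
      (AntipodalRow-multiple d d∣n/2 λ { zero → refl ; (suc _) → refl })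

    ¬IsNut-of-nonconstant : ∀ p .{{_ : NonZero p}} F → InNullSpace (T4 n a b) (lift (periodic p F)) →
      F X (0 % p) ≢ F X (1 % p) → ¬ IsNut (T4 n a b)
    ¬IsNut-of-nonconstant p F F-null F₀≢F₁ =
      ¬IsNut-of-independent (T4 n a b) (null-at-multiples 1 (1∣ _) (1∣ a) (1∣ b)) F-null
        (vertex X (fromℕ< 0<n)) (vertex X (fromℕ< 1<n)) λ eq → F₀≢F₁ (sym (begin
          F X (1 % p)          ≡⟨ ℚP.*-identityˡ _ ⟨
          1ℚ * F X (1 % p)     ≡⟨ cong₂ _*_ (x-value {1} at-zero 0<n) (x-value F 1<n) ⟨
          _                    ≡⟨ eq ⟩
          _                    ≡⟨ cong₂ _*_ (x-value {1} at-zero 1<n) (x-value F 0<n) ⟩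
          1ℚ * F X (0 % p)     ≡⟨ ℚP.*-identityˡ _ ⟩
          F X (0 % p)          ∎))
      where open ≡-Reasoning

    common-divisor-obstruction : ∀ d → 1 < d → d ∣ n / 2 → d ∣ a → d ∣ b → ¬ IsNut (T4 n a b)
    common-divisor-obstruction d 1<d d∣n/2 d∣a d∣b =
      ¬IsNut-of-nonconstant d at-zero (null-at-multiples d d∣n/2 d∣a d∣b) λ eq →
        1ℚ≢0ℚ (subst₂ (λ u w → at-zero X u ≡ at-zero X w) (m<n⇒m%n≡m 0<d) (m<n⇒m%n≡m 1<d) eq)
      where
      0<d : 0 < d
      0<d = ℕP.<-trans z<s 1<d
      instance
        d-nonZero : NonZero d
        d-nonZero = ℕ.>-nonZero 0<d
      1ℚ≢0ℚ : 1ℚ ≢ 0ℚ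
      1ℚ≢0ℚ ()

    alternating-obstruction : ¬ 2 ∣ a → ¬ 2 ∣ b → ¬ 2 ∣ n / 2 → ¬ IsNut (T4 n a b)
    alternating-obstruction ¬2∣a ¬2∣b ¬2∣n/2 = ¬IsNut-of-nonconstant 2 alternating
      (null 2∣n alternating
        (CycleRow-by-residues 2 1 (odd⇒%2≡1 a ¬2∣a) (decide-vanishing _ _))
        (CycleRow-by-residues 2 1 (odd⇒%2≡1 b ¬2∣b) (decide-vanishing _ _))
        (AntipodalRow-by-residues 2 1 (odd⇒%2≡1 (n / 2) ¬2∣n/2) (decide-vanishing _ _)))
      (λ ())

    wave-obstruction : 4 ∣ n → ¬ 2 ∣ a → ¬ 2 ∣ b → ¬ IsNut (T4 n a b)
    wave-obstruction 4∣n ¬2∣a ¬2∣b = ¬IsNut-of-nonconstant 4 F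
      (null 4∣n F (odd-row wave (decide-vanishing _ _) (decide-vanishing _ _) ¬2∣a)
                  (odd-row (ℚ.-_ ∘ wave) (decide-vanishing _ _) (decide-vanishing _ _) ¬2∣b)
                  (AntipodalRow-by-residues 4 (n / 2 % 4) refl (decide-vanishing _ _)))
      (λ ())
      where
      F : Fin 3 → ℕ → ℚ
      F = ⟨ wave , ℚ.-_ ∘ wave , (λ _ → 0ℚ) ⟩
      odd-row : ∀ f {d} →
        (∀ (r : Fin 4) → f ((toℕ r ℕ.+ 1 ℕ.+ 1) % 4) + f (toℕ r) + 0ℚ ≡ 0ℚ) →
        (∀ (r : Fin 4) → f ((toℕ r ℕ.+ 3 ℕ.+ 3) % 4) + f (toℕ r) + 0ℚ ≡ 0ℚ) →
        ¬ 2 ∣ d → CycleRow 4 d f (λ _ → 0ℚ)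
      odd-row f {d} shift-by-1 shift-by-3 ¬2∣d with odd⇒%4≡1∨3 d ¬2∣d
      ... | inj₁ d≡1 = CycleRow-by-residues 4 1 d≡1 shift-by-1
      ... | inj₂ d≡3 = CycleRow-by-residues 4 3 d≡3 shift-by-3

    pentagonal-obstruction : 5 ∣ n / 2 → (±1 (a % 5) × ±2 (b % 5)) ⊎ (±2 (a % 5) × ±1 (b % 5)) →
      ¬ IsNut (T4 n a b)
    pentagonal-obstruction 5∣n/2 (inj₁ (a≡±1 , b≡±2)) = ¬IsNut-of-nonconstant 5 ⟨ pent₁ , pent₂ , pentᶻ ⟩
      (null (∣-trans 5∣n/2 (m/n∣m 2∣n)) ⟨ pent₁ , pent₂ , pentᶻ ⟩ (pent₁-row a≡±1) (pent₂-row b≡±2)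
        (AntipodalRow-multiple 5 5∣n/2 λ { 0 → refl ; 1 → refl ; 2 → refl ; 3 → refl ; (suc (suc (suc (suc _)))) → refl }))
      (λ ())
    pentagonal-obstruction 5∣n/2 (inj₂ (a≡±2 , b≡±1)) = ¬IsNut-of-nonconstant 5 ⟨ pent₂ , pent₁ , pentᶻ ⟩
      (null (∣-trans 5∣n/2 (m/n∣m 2∣n)) ⟨ pent₂ , pent₁ , pentᶻ ⟩ (pent₂-row a≡±2) (pent₁-row b≡±1)
        (AntipodalRow-multiple 5 5∣n/2 λ { 0 → refl ; 1 → refl ; 2 → refl ; 3 → refl ; (suc (suc (suc (suc _)))) → refl }))
      (λ ())

    nut⇒Cond-i : IsNut (T4 n a b) → Cond-i n a b
    nut⇒Cond-i nut = decidable-stable (g ℕ.≟ 1) λ g≢1 →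
      common-divisor-obstruction g (∣-≢1⇒1< 0<b (gcd[m,n]∣n g′ b) g≢1)
        (∣-trans (gcd[m,n]∣m g′ b) (gcd[m,n]∣m (n / 2) a)) (∣-trans (gcd[m,n]∣m g′ b) (gcd[m,n]∣n (n / 2) a))
        (gcd[m,n]∣n g′ b) nut
      where
      g′ = gcd (n / 2) a
      g = gcd g′ b

    nut⇒Cond-ii : IsNut (T4 n a b) → Cond-ii n a b
    nut⇒Cond-ii nut ¬4∣n = decidable-stable (2 ∣? a ⊎-dec 2 ∣? b) λ neither →
      alternating-obstruction (neither ∘ inj₁) (neither ∘ inj₂) (¬4∣n ∘ m∣n/o⇒m*o∣n 2∣n) nut

    nut⇒Cond-iii : IsNut (T4 n a b) → Cond-iii n a b
    nut⇒Cond-iii nut 4∣n with 2 ∣? a | 2 ∣? b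
    ... | yes 2∣a | yes 2∣b = ⊥-elim (common-divisor-obstruction 2 (s<s z<s) (m*n∣o⇒m∣o/n 2 2 4∣n) 2∣a 2∣b nut)
    ... | yes 2∣a | no ¬2∣b = inj₁ (2∣a , ¬2∣b)
    ... | no ¬2∣a | yes 2∣b = inj₂ (¬2∣a , 2∣b)
    ... | no ¬2∣a | no ¬2∣b = ⊥-elim (wave-obstruction 4∣n ¬2∣a ¬2∣b nut)

    nut⇒Cond-iv : IsNut (T4 n a b) → Cond-iv n a b
    nut⇒Cond-iv nut 10∣n =
      decidable-stable (5 ∣? a ⊎-dec 5 ∣? b ⊎-dec 5 ∣? ℤ.∣ ℤ.+ a ℤ.- ℤ.+ b ∣ ⊎-dec 5 ∣? a ℕ.+ b) λ none →
        pentagonal-obstruction (m*n∣o⇒m∣o/n 5 2 10∣n)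
          (nonzero-residues-mod5 (m%n<n a 5) (m%n<n b 5)
            (none ∘ inj₁ ∘ m%n≡0⇒n∣m a 5)
            (none ∘ inj₂ ∘ inj₁ ∘ m%n≡0⇒n∣m b 5)
            (none ∘ inj₂ ∘ inj₂ ∘ inj₁ ∘ ≡-mod⇒∣- a b)
            (none ∘ inj₂ ∘ inj₂ ∘ inj₂ ∘ m%n≡0⇒n∣m (a ℕ.+ b) 5 ∘ trans (%-distribˡ-+ a b 5)))
          nut

lemma6p4 : (n a b : ℕ) .{{_ : NonZero n}} → 2 ∣ n
    → 1 ≤ a → a < n / 2 → 1 ≤ b → b < n / 2
    → ¬ (Cond-i n a b × Cond-ii n a b × Cond-iii n a b × Cond-iv n a b)
    → ¬ IsNut (T4 n a b)
lemma6p4 n a b 2∣n 1≤a a<n/2 1≤b b<n/2 ¬conditions nut =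
  ¬conditions (nut⇒Cond-i nut , nut⇒Cond-ii nut , nut⇒Cond-iii nut , nut⇒Cond-iv nut)
  where open T₄.Necessary n a b 2∣n 1≤a a<n/2 1≤b b<n/2
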